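{- Let $F$ and $F'$ be graphs with no isolated vertices. If $F'$ is a clique-dual of $F$, then $F$ is also a clique-dual of $F'$.
   Context: All graphs are finite and simple. Let $F$ and $F'$ be graphs with no isolated vertices, and let $v_1,\dots,v_n$ be the vertices of $F$. We say $F'$ is a clique-dual of $F$ if there is a family $Cl_1,\dots,Cl_n$ of cliques of $F'$ (vertex sets inducing complete subgraphs), indexed by the vertices of $F$, such that every edge of $F'$ has both ends in at least one $Cl_i$, and for distinct $i,j$, $v_i$ is adjacent to $v_j$ in $F$ if and only if $Cl_i\cap Cl_j\neq\emptyset$. -}

module Defs where

open import Data.Nat using (ℕ)
open import Data.Fin using (Fin)
open import Data.Fin.Subset using (Subset; _∈_)
open import Data.Bool using (Bool; true; false)
open import Data.Product using (Σ; ∃; _×_; _,_)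
open import Relation.Binary.PropositionalEquality using (_≡_; _≢_)
open import Relation.Nullary using (¬_)

record Graph (n : ℕ) : Set where
  field
    adj     : Fin n → Fin n → Bool
    symm    : ∀ i j → adj i j ≡ adj j i
    irrefl  : ∀ i → adj i i ≡ false

open Graph public

Adj : ∀ {n} → Graph n → Fin n → Fin n → Set
Adj G i j = adj G i j ≡ true

NoIsolated : ∀ {n} → Graph n → Set
NoIsolated {n} G = ∀ (i : Fin n) → ∃ λ (j : Fin n) → Adj G i j

IsClique : ∀ {m} → Graph m → Subset m → Set
IsClique G C = ∀ x y → x ∈ C → y ∈ C → x ≢ y → Adj G x y

Meets : ∀ {m} → Subset m → Subset m → Set
Meets {m} C D = ∃ λ (x : Fin m) → x ∈ C × x ∈ D

record CliqueDual {n m : ℕ} (F : Graph n) (F' : Graph m) : Set where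
  field
    Cl       : Fin n → Subset m
    clique   : ∀ i → IsClique F' (Cl i)
    covers   : ∀ x y → Adj F' x y → ∃ λ (i : Fin n) → x ∈ Cl i × y ∈ Cl i
    adj⇒meet : ∀ i j → i ≢ j → Adj F i j → Meets (Cl i) (Cl j)
    meet⇒adj : ∀ i j → i ≢ j → Meets (Cl i) (Cl j) → Adj F i j

-- The dual cliques are the transposed incidence: vertex x of F' is sent to
-- Cl'_x = { i | x ∈ Cl_i }. Transposing swaps the two remaining conditions:
-- Cl'_i ∩ Cl'_j ≠ ∅ says that x, y lie in a common Cl_i, which happens for
-- x ≠ y exactly when they are adjacent (each Cl_i is a clique and the Cl_i
-- cover the edges); and Cl'_x is a clique of F because two vertices of F
-- whose cliques share x are adjacent. No isolated vertices are needed.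
module Submission where

open import Defs
open import Data.Nat using (ℕ)
open import Data.Fin using (Fin)
open import Data.Fin.Subset using (Subset; _∈_)
open import Data.Fin.Subset.Properties using (_∈?_)
open import Data.Bool.Properties using (T-≡)
open import Data.Vec using (tabulate)
open import Data.Vec.Properties using ([]=⇒lookup; lookup⇒[]=; lookup∘tabulate)
open import Data.Product using (∃; _×_; _,_)
open import Function.Bundles using (Equivalence)
open import Relation.Binary.PropositionalEquality using (_≢_; refl; sym; trans)
open import Relation.Nullary.Decidable using (⌊_⌋; fromWitness; toWitness)

Adj⇒≢ : ∀ {k} (G : Graph k) {i j : Fin k} → Adj G i j → i ≢ j
Adj⇒≢ G {i} i~i refl with trans (sym i~i) (irrefl G i)
... | ()

transpose : ∀ {n m} → (Fin n → Subset m) → Fin m → Subset n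
transpose C x = tabulate λ i → ⌊ x ∈? C i ⌋

module _ {n m} (C : Fin n → Subset m) {i : Fin n} {x : Fin m} where

  ∈-transpose⁺ : x ∈ C i → i ∈ transpose C x
  ∈-transpose⁺ x∈Ci =
    lookup⇒[]= i _ (trans (lookup∘tabulate _ i) (Equivalence.to T-≡ (fromWitness x∈Ci)))

  ∈-transpose⁻ : i ∈ transpose C x → x ∈ C i
  ∈-transpose⁻ i∈Cᵀx =
    toWitness (Equivalence.from T-≡ (trans (sym (lookup∘tabulate _ i)) ([]=⇒lookup i∈Cᵀx)))

module _ {n m} (C : Fin n → Subset m) where

  meets⇒common-transpose : ∀ {i j} → Meets (C i) (C j) →
    ∃ λ x → i ∈ transpose C x × j ∈ transpose C x
  meets⇒common-transpose (x , x∈Ci , x∈Cj) =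
    x , ∈-transpose⁺ C x∈Ci , ∈-transpose⁺ C x∈Cj

  common⇒meets-transpose : ∀ {x y} → (∃ λ i → x ∈ C i × y ∈ C i) →
    Meets (transpose C x) (transpose C y)
  common⇒meets-transpose (i , x∈Ci , y∈Ci) =
    i , ∈-transpose⁺ C x∈Ci , ∈-transpose⁺ C y∈Ci

  meets-transpose⇒common : ∀ {x y} → Meets (transpose C x) (transpose C y) →
    ∃ λ i → x ∈ C i × y ∈ C i
  meets-transpose⇒common (i , i∈Cᵀx , i∈Cᵀy) =
    i , ∈-transpose⁻ C i∈Cᵀx , ∈-transpose⁻ C i∈Cᵀy

CliqueDual-sym : ∀ {n m} {F : Graph n} {F' : Graph m} →
  CliqueDual F F' → CliqueDual F' F
CliqueDual-sym {F = F} D = record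
  { Cl       = transpose Cl
  ; clique   = λ x i j i∈Cᵀx j∈Cᵀx i≢j →
      meet⇒adj i j i≢j (x , ∈-transpose⁻ Cl i∈Cᵀx , ∈-transpose⁻ Cl j∈Cᵀx)
  ; covers   = λ i j i~j → meets⇒common-transpose Cl (adj⇒meet i j (Adj⇒≢ F i~j) i~j)
  ; adj⇒meet = λ x y _ x~y → common⇒meets-transpose Cl (covers x y x~y)
  ; meet⇒adj = λ x y x≢y meet →
      let (i , x∈Ci , y∈Ci) = meets-transpose⇒common Cl meet
      in clique i x y x∈Ci y∈Ci x≢y
  }
  where open CliqueDual D

proposition5 : ∀ {n m : ℕ} (F : Graph n) (F' : Graph m) →
    NoIsolated F → NoIsolated F' →
    CliqueDual F F' → CliqueDual F' F
proposition5 _ _ _ _ = CliqueDual-sym
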